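{- For every integer $n\ge 3$, the cycle $C_n$ on $n$ vertices satisfies $st_{id}(C_n)=3$ if $n\equiv 0\pmod 3$, $st_{id}(C_n)=2$ if $n\equiv 2\pmod 3$, and $st_{id}(C_n)=1$ if $n\equiv 1\pmod 3$.
   Context: All graphs are finite and simple. An independent dominating set of a graph $G$ is a set $S\subseteq V(G)$ of pairwise non-adjacent vertices such that every vertex not in $S$ has a neighbour in $S$. The independent domination number $\gamma_i(G)$ is the minimum size of an independent dominating set (for the null graph with no vertices, $\gamma_i=0$). The independent domination stability $st_{id}(G)$ is the minimum number of vertices whose removal from $G$ yields a graph with independent domination number different from $\gamma_i(G)$. -}

module Defs where

open import Data.Nat using (ℕ; zero; suc; _≤_; _<_)
open import Data.Fin using (Fin; toℕ)
open import Data.Fin.Subset using (Subset; _∈_; _∉_; _⊆_; ∣_∣; ∁; ⊤)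
open import Data.Product using (Σ; _×_; ∃; ∃-syntax)
open import Data.Sum using (_⊎_)
open import Relation.Nullary using (¬_)
open import Relation.Binary.PropositionalEquality using (_≡_; _≢_)

Rel : ℕ → Set₁
Rel n = Fin n → Fin n → Set

CycleAdj : (n : ℕ) → Rel n
CycleAdj n i j =
  (toℕ j ≡ suc (toℕ i)) ⊎ (toℕ i ≡ suc (toℕ j)) ⊎
  ((toℕ j ≡ 0 × suc (toℕ i) ≡ n) ⊎ (toℕ i ≡ 0 × suc (toℕ j) ≡ n))

-- S is an independent dominating set of the induced subgraph G[W]
-- (i.e. of G with the vertices outside W removed).
IsIndepDom : {n : ℕ} → Rel n → Subset n → Subset n → Set
IsIndepDom {n} Adj W S =
  (S ⊆ W) ×
  ((u v : Fin n) → u ∈ S → v ∈ S → ¬ Adj u v) ×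
  ((v : Fin n) → v ∈ W → v ∉ S → ∃[ u ] (u ∈ S × Adj u v))

IsIndepDomNum : {n : ℕ} → Rel n → Subset n → ℕ → Set
IsIndepDomNum {n} Adj W k =
  (∃[ S ] (IsIndepDom Adj W S × ∣ S ∣ ≡ k)) ×
  ((S : Subset n) → IsIndepDom Adj W S → k ≤ ∣ S ∣)

ChangesγI : {n : ℕ} → Rel n → Subset n → Set
ChangesγI Adj R =
  ∃[ a ] ∃[ b ] (IsIndepDomNum Adj ⊤ a × IsIndepDomNum Adj (∁ R) b × a ≢ b)

IsIdStability : {n : ℕ} → Rel n → ℕ → Set
IsIdStability {n} Adj k =
  (∃[ R ] (∣ R ∣ ≡ k × ChangesγI Adj R)) ×
  ((R : Subset n) → ∣ R ∣ < k → ¬ ChangesγI Adj R)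

-- A vertex of C_n dominates at most itself and its two neighbours, so an independent
-- dominating set of C_n − R has at least (n − |R|)/3 elements. Conversely, choosing the
-- middle one of every three consecutive vertices along each run of remaining vertices
-- (and one vertex of a shorter remainder) gives an independent dominating set of at most
-- (length + 2 · #runs)/3 elements. On the whole cycle this gives γ_i(C_n) = ⌈n/3⌉; for
-- R ≠ ∅, cutting the cycle at a removed vertex leaves at most |R| runs, so
-- γ_i(C_n − R) ≤ (n + |R|)/3. Below the claimed stability the two bounds force
-- γ_i(C_n − R) = ⌈n/3⌉, whereas removing that many consecutive vertices leaves a path
-- P_j with γ_i(P_j) = ⌈j/3⌉ < ⌈n/3⌉.

{-# OPTIONS --safe #-}
module Submission where

open import Data.Bool.Base as Bool using (Bool; true; false; not; _∧_; b≤b; f≤t)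
open import Data.Bool.Properties using (∧-zeroʳ)
open import Data.Empty using (⊥; ⊥-elim)
open import Data.Fin.Base using (Fin; zero; suc; toℕ; fromℕ)
open import Data.Fin.Properties using (toℕ-fromℕ)
open import Data.Fin.Subset using (Subset; _∈_; _∉_; _⊆_; ∣_∣; ∁; ⊤)
open import Data.Fin.Subset.Properties using (∣⊥∣≡0; ∣⊤∣≡n; ∣p∣≤n; ∣∁p∣≡n∸∣p∣; ∣p∣≡n⇒p≡⊤)
open import Data.List.Base using (List; []; _∷_; _++_; length; replicate)
open import Data.List.Properties using (++-identityʳ)
open import Data.List.Relation.Binary.Pointwise using (Pointwise; []; _∷_; ++⁺; Pointwise-length)
open import Data.Nat.Base using (ℕ; zero; suc; _+_; _*_; _∸_; _≤_; _<_; z≤n; s≤s; _/_; _%_)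
open import Data.Nat.DivMod using (m≡m%n+[m/n]*n; m%n<n)
open import Data.Nat.Properties
open import Data.Nat.Tactic.RingSolver using (solve-∀)
open import Data.Product using (∃-syntax; ∃₂; _×_; _,_; proj₁; proj₂)
open import Data.Sum using (_⊎_; inj₁; inj₂)
open import Data.Vec.Base as Vec using (Vec; []; _∷_; lookup; toList; here; there)
import Data.Vec.Properties as Vecₚ
open import Function.Base using (_∘_; case_of_)
open import Relation.Binary.PropositionalEquality
open import Relation.Nullary using (¬_; yes; no)

open import Defs

private variable
  n m : ℕ
  p q x : Bool
  w s a b xs ys ws ss : List Bool

bit : Bool → ℕ
bit false = 0
bit true  = 1

trues falses : List Bool → ℕ
trues []       = 0
trues (x ∷ xs) = bit x + trues xs
falses []       = 0
falses (x ∷ xs) = bit (not x) + falses xs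

headOr lastOr : Bool → List Bool → Bool
headOr d []      = d
headOr d (x ∷ _) = x
lastOr d []       = d
lastOr d (x ∷ xs) = lastOr x xs

trues-++ : ∀ xs ys → trues (xs ++ ys) ≡ trues xs + trues ys
trues-++ []       ys = refl
trues-++ (x ∷ xs) ys = trans (cong (bit x +_) (trues-++ xs ys)) (sym (+-assoc (bit x) _ _))

falses-++ : ∀ xs ys → falses (xs ++ ys) ≡ falses xs + falses ys
falses-++ []       ys = refl
falses-++ (x ∷ xs) ys = trans (cong (bit (not x) +_) (falses-++ xs ys)) (sym (+-assoc (bit (not x)) _ _))

trues-++-comm : ∀ xs ys → trues (xs ++ ys) ≡ trues (ys ++ xs)
trues-++-comm xs ys = trans (trues-++ xs ys) (trans (+-comm (trues xs) _) (sym (trues-++ ys xs)))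

falses-++-comm : ∀ xs ys → falses (xs ++ ys) ≡ falses (ys ++ xs)
falses-++-comm xs ys = trans (falses-++ xs ys) (trans (+-comm (falses xs) _) (sym (falses-++ ys xs)))

headOr-++ : ∀ d xs ys → headOr d (xs ++ ys) ≡ headOr (headOr d ys) xs
headOr-++ d []      ys = refl
headOr-++ d (_ ∷ _) ys = refl

lastOr-++ : ∀ d xs ys → lastOr d (xs ++ ys) ≡ lastOr (lastOr d xs) ys
lastOr-++ d []       ys = refl
lastOr-++ d (x ∷ xs) ys = lastOr-++ x xs ys

-- A word w : List Bool lists the vertices of a path and marks which of them are
-- present; a word s ⊑ w marks a chosen set. The Bool arguments p and q give the
-- membership in s of the outside neighbours before the first and after the last
-- vertex; IsCyclicIDS closes the path into a cycle by taking for them the last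
-- and the first letter of s.

infix 4 _⊑_

_⊑_ : List Bool → List Bool → Set
_⊑_ = Pointwise Bool._≤_

data Independent : Bool → List Bool → Set where
  []  : Independent p []
  _∷_ : p ∧ x ≡ false → Independent x xs → Independent p (x ∷ xs)

Covered : Bool → Bool → Bool → Bool → Set
Covered l y r x = x ≡ true → l ≡ true ⊎ y ≡ true ⊎ r ≡ true

by-left : ∀ {y r x} → Covered true y r x
by-left _ = inj₁ refl

by-itself : ∀ {l r x} → Covered l true r x
by-itself _ = inj₂ (inj₁ refl)

by-right : ∀ {l y x} → Covered l y true x
by-right _ = inj₂ (inj₂ refl)

absent : ∀ {l y r} → Covered l y r false
absent ()

data Dominates : Bool → Bool → List Bool → List Bool → Set where
  []  : Dominates p q [] []
  _∷_ : ∀ {x y} → Covered p y (headOr q ss) x → Dominates y q ws ss → Dominates p q (x ∷ ws) (y ∷ ss)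

IsCyclicIDS : List Bool → List Bool → Set
IsCyclicIDS w s = s ⊑ w × Independent (lastOr false s) s × Dominates (lastOr false s) (headOr false s) w s

-- The greedy solution on a path

greedy : List Bool → List Bool
greedy []                       = []
greedy (false ∷ w)              = false ∷ greedy w
greedy (true ∷ [])              = true ∷ []
greedy (true ∷ false ∷ w)       = true ∷ false ∷ greedy w
greedy (true ∷ true ∷ [])       = true ∷ false ∷ []
greedy (true ∷ true ∷ false ∷ w) = true ∷ false ∷ false ∷ greedy w
greedy (true ∷ true ∷ true ∷ w)  = false ∷ true ∷ false ∷ greedy w

runs : List Bool → ℕ
runs []                  = 0
runs (false ∷ w)         = runs w
runs (true ∷ [])         = 1
runs (true ∷ false ∷ w)  = suc (runs w)
runs (true ∷ w@(true ∷ _)) = runs w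

greedy-⊑ : ∀ w → greedy w ⊑ w
greedy-⊑ []                        = []
greedy-⊑ (false ∷ w)               = b≤b ∷ greedy-⊑ w
greedy-⊑ (true ∷ [])               = b≤b ∷ []
greedy-⊑ (true ∷ false ∷ w)        = b≤b ∷ b≤b ∷ greedy-⊑ w
greedy-⊑ (true ∷ true ∷ [])        = b≤b ∷ f≤t ∷ []
greedy-⊑ (true ∷ true ∷ false ∷ w) = b≤b ∷ f≤t ∷ b≤b ∷ greedy-⊑ w
greedy-⊑ (true ∷ true ∷ true ∷ w)  = f≤t ∷ b≤b ∷ f≤t ∷ greedy-⊑ w

greedy-independent : ∀ w → Independent false (greedy w)
greedy-independent []                        = []
greedy-independent (false ∷ w)               = refl ∷ greedy-independent w
greedy-independent (true ∷ [])               = refl ∷ []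
greedy-independent (true ∷ false ∷ w)        = refl ∷ refl ∷ greedy-independent w
greedy-independent (true ∷ true ∷ [])        = refl ∷ refl ∷ []
greedy-independent (true ∷ true ∷ false ∷ w) = refl ∷ refl ∷ refl ∷ greedy-independent w
greedy-independent (true ∷ true ∷ true ∷ w)  = refl ∷ refl ∷ refl ∷ greedy-independent w

greedy-dominates : ∀ w → Dominates p q w (greedy w)
greedy-dominates []                        = []
greedy-dominates (false ∷ w)               = absent ∷ greedy-dominates w
greedy-dominates (true ∷ [])               = by-itself ∷ []
greedy-dominates (true ∷ false ∷ w)        = by-itself ∷ absent ∷ greedy-dominates w
greedy-dominates (true ∷ true ∷ [])        = by-itself ∷ by-left ∷ []
greedy-dominates (true ∷ true ∷ false ∷ w) = by-itself ∷ by-left ∷ absent ∷ greedy-dominates w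
greedy-dominates (true ∷ true ∷ true ∷ w)  = by-right ∷ by-itself ∷ by-left ∷ greedy-dominates w

runs-≤-runs-∷ : ∀ w → runs w ≤ runs (true ∷ w)
runs-≤-runs-∷ []          = z≤n
runs-≤-runs-∷ (false ∷ w) = n≤1+n (runs w)
runs-≤-runs-∷ (true ∷ w)  = ≤-refl

interchange : ∀ b c t r → (b + c * 2) + (t + r * 2) ≡ (b + t) + (c + r) * 2
interchange = solve-∀

-- A block reads b present vertices, chooses one of them and closes c ∈ {0, 1} runs.
greedy-block : ∀ b c k t r → 3 ≤ b + c * 2 → k * 3 ≤ t + r * 2 → suc k * 3 ≤ (b + t) + (c + r) * 2
greedy-block b c k t r block rest = begin
  3 + k * 3                 ≤⟨ +-mono-≤ block rest ⟩
  (b + c * 2) + (t + r * 2) ≡⟨ interchange b c t r ⟩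
  (b + t) + (c + r) * 2     ∎
  where open ≤-Reasoning

greedy-count : ∀ w → trues (greedy w) * 3 ≤ trues w + runs w * 2
greedy-count []                        = z≤n
greedy-count (false ∷ w)               = greedy-count w
greedy-count (true ∷ [])               = greedy-block 1 1 0 0 0 ≤-refl z≤n
greedy-count (true ∷ false ∷ w)        = greedy-block 1 1 (trues (greedy w)) _ (runs w) ≤-refl (greedy-count w)
greedy-count (true ∷ true ∷ [])        = greedy-block 2 1 0 0 0 (m≤n+m 3 1) z≤n
greedy-count (true ∷ true ∷ false ∷ w) = greedy-block 2 1 (trues (greedy w)) _ (runs w) (m≤n+m 3 1) (greedy-count w)
greedy-count (true ∷ true ∷ true ∷ w)  = greedy-block 3 0 (trues (greedy w)) _ (runs (true ∷ w)) ≤-refl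
  (≤-trans (greedy-count w) (+-monoʳ-≤ (trues w) (*-monoˡ-≤ 2 (runs-≤-runs-∷ w))))

runs-≤-falses : ∀ w → runs w ≤ suc (falses w)
runs-≤-falses []                    = z≤n
runs-≤-falses (false ∷ w)           = m≤n⇒m≤1+n (runs-≤-falses w)
runs-≤-falses (true ∷ [])           = ≤-refl
runs-≤-falses (true ∷ false ∷ w)    = s≤s (runs-≤-falses w)
runs-≤-falses (true ∷ w@(true ∷ _)) = runs-≤-falses w

runs-replicate : ∀ j → runs (replicate j true) ≤ 1
runs-replicate zero          = z≤n
runs-replicate (suc zero)    = ≤-refl
runs-replicate (suc (suc j)) = runs-replicate (suc j)

trues-replicate : ∀ j → trues (replicate j true) ≡ j
trues-replicate zero    = refl
trues-replicate (suc j) = cong suc (trues-replicate j)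

greedy-replicate : ∀ j → trues (greedy (replicate j true)) * 3 ≤ j + 2
greedy-replicate j = begin
  trues (greedy (replicate j true)) * 3                   ≤⟨ greedy-count (replicate j true) ⟩
  trues (replicate j true) + runs (replicate j true) * 2  ≤⟨ +-mono-≤ (≤-reflexive (trues-replicate j))
                                                                     (*-monoˡ-≤ 2 (runs-replicate j)) ⟩
  j + 2                                                   ∎
  where open ≤-Reasoning

greedy-cyclic : ∀ w {s} → greedy w ≡ false ∷ s → IsCyclicIDS w (greedy w)
greedy-cyclic w {s} starts-false = greedy-⊑ w , independent , greedy-dominates w
  where
  independent : Independent (lastOr false (greedy w)) (greedy w)
  independent rewrite starts-false with subst (Independent false) starts-false (greedy-independent w)
  ... | _ ∷ rest = ∧-zeroʳ _ ∷ rest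

-- Cutting and rotating cyclic solutions

⊑-++⁻ : ∀ xs {ys s} → s ⊑ xs ++ ys → ∃₂ λ a b → s ≡ a ++ b × a ⊑ xs × b ⊑ ys
⊑-++⁻ []       s⊑ys = [] , _ , refl , [] , s⊑ys
⊑-++⁻ (x ∷ xs) (r ∷ rs) with ⊑-++⁻ xs rs
... | a , b , refl , a⊑xs , b⊑ys = _ ∷ a , b , refl , r ∷ a⊑xs , b⊑ys

Independent-++⁻ : ∀ a → Independent p (a ++ b) → Independent p a × Independent (lastOr p a) b
Independent-++⁻ []      ind        = [] , ind
Independent-++⁻ (_ ∷ a) (i ∷ ind) = let ia , ib = Independent-++⁻ a ind in i ∷ ia , ib

Independent-++⁺ : Independent p a → Independent (lastOr p a) b → Independent p (a ++ b)
Independent-++⁺ []        ib = ib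
Independent-++⁺ (i ∷ ia) ib = i ∷ Independent-++⁺ ia ib

Dominates-++⁻ : ∀ {xs ys} a → length xs ≡ length a → Dominates p q (xs ++ ys) (a ++ b) →
                Dominates p (headOr q b) xs a × Dominates (lastOr p a) q ys b
Dominates-++⁻ {xs = []}    []      _   dom       = [] , dom
Dominates-++⁻ {q = q} {b = b} {xs = _ ∷ _} (_ ∷ a) eq (d ∷ dom) =
  let da , db = Dominates-++⁻ a (suc-injective eq) dom
  in  subst (λ r → Covered _ _ r _) (headOr-++ q a b) d ∷ da , db

Dominates-++⁺ : ∀ {xs ys} → Dominates p (headOr q b) xs a → Dominates (lastOr p a) q ys b →
                Dominates p q (xs ++ ys) (a ++ b)
Dominates-++⁺ []                          db = db
Dominates-++⁺ {q = q} {b = b} {a = _ ∷ a} (d ∷ da) db =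
  subst (λ r → Covered _ _ r _) (sym (headOr-++ q a b)) d ∷ Dominates-++⁺ da db

lastOr-rotate : ∀ a b → lastOr (lastOr false (a ++ b)) a ≡ lastOr false (b ++ a)
lastOr-rotate []      b = cong (lastOr false) (sym (++-identityʳ b))
lastOr-rotate (x ∷ a) b = sym (lastOr-++ false b (x ∷ a))

headOr-rotate : ∀ a b → headOr (headOr false (b ++ a)) a ≡ headOr false (a ++ b)
headOr-rotate []      b = cong (headOr false) (++-identityʳ b)
headOr-rotate (x ∷ a) b = refl

rotate : ∀ xs ys → IsCyclicIDS (xs ++ ys) s → ∃[ s′ ] IsCyclicIDS (ys ++ xs) s′ × trues s′ ≡ trues s
rotate xs ys (incl , ind , dom) with ⊑-++⁻ xs incl
... | a , b , refl , a⊑xs , b⊑ys = b ++ a , (++⁺ b⊑ys a⊑xs , ind′ , dom′) , trues-++-comm b a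
  where
  ind-split = Independent-++⁻ a ind
  dom-split = Dominates-++⁻ a (sym (Pointwise-length a⊑xs)) dom
  ind′ = Independent-++⁺ (subst (λ p → Independent p b) (lastOr-rotate a b) (proj₂ ind-split))
                         (subst (λ p → Independent p a) (sym (lastOr-rotate b a)) (proj₁ ind-split))
  dom′ = Dominates-++⁺
    (subst₂ (λ p q → Dominates p q ys b) (lastOr-rotate a b) (sym (headOr-rotate a b)) (proj₂ dom-split))
    (subst₂ (λ p q → Dominates p q xs a) (sym (lastOr-rotate b a)) (headOr-rotate b a) (proj₁ dom-split))

false-split : ∀ w → 1 ≤ falses w → ∃₂ λ u v → w ≡ u ++ false ∷ v
false-split (false ∷ w) _ = [] , w , refl
false-split (true ∷ w) h with false-split w h
... | u , v , refl = true ∷ u , v , refl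

-- Rotating a missing vertex to the front turns the cycle into a path, so the
-- greedy bound applies with at most one run per missing vertex.
cyclic-upper-bound : ∀ w → 1 ≤ falses w → ∃[ s ] IsCyclicIDS w s × trues s * 3 ≤ trues w + falses w * 2
cyclic-upper-bound w h with false-split w h
... | u , v , refl with rotate (false ∷ v) u (greedy-cyclic (false ∷ v ++ u) refl)
...   | s , cyc , same = s , cyc , (begin
  trues s * 3                            ≡⟨ cong (_* 3) same ⟩
  trues (greedy w′) * 3                  ≤⟨ greedy-count w′ ⟩
  trues w′ + runs w′ * 2                 ≤⟨ +-monoʳ-≤ (trues w′) (*-monoˡ-≤ 2 (runs-≤-falses (v ++ u))) ⟩
  trues w′ + falses w′ * 2               ≡⟨ cong₂ (λ t f → t + f * 2) (trues-++-comm (false ∷ v) u)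
                                                                      (falses-++-comm (false ∷ v) u) ⟩
  trues (u ++ false ∷ v) + falses (u ++ false ∷ v) * 2 ∎)
  where
  open ≤-Reasoning
  w′ = false ∷ v ++ u

bit-covered : ∀ {x y h} → Covered p y h x → bit x ≤ bit p + bit y + bit h
bit-covered {x = false} _ = z≤n
bit-covered {p = p} {x = true} {y} {h} d with d refl
... | inj₁ refl        = s≤s z≤n
... | inj₂ (inj₁ refl) = ≤-trans (m≤n+m 1 (bit p)) (m≤m+n _ (bit h))
... | inj₂ (inj₂ refl) = m≤n+m 1 (bit p + bit y)

-- Each chosen vertex dominates at most three vertices; the boundary terms
-- account for the outside neighbours p, q and for the first and last vertex.
dominated-count : Dominates p q w s → trues w + bit (headOr q s) + bit (lastOr p s) ≤ trues s * 3 + bit p + bit q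
dominated-count {p} {q} [] = ≤-reflexive (+-comm (bit q) (bit p))
dominated-count {p} {q} {w = x ∷ ws} {s = y ∷ ss} (d ∷ dom) = begin
  bit x + trues ws + bit y + bit (lastOr y ss)                            ≤⟨ +-monoˡ-≤ _ (+-monoˡ-≤ _ (+-monoˡ-≤ _ (bit-covered d))) ⟩
  bit p + bit y + bit (headOr q ss) + trues ws + bit y + bit (lastOr y ss) ≡⟨ regroup (bit p) (bit y) _ _ _ ⟩
  (trues ws + bit (headOr q ss) + bit (lastOr y ss)) + (bit p + bit y + bit y) ≤⟨ +-monoˡ-≤ _ (dominated-count dom) ⟩
  (trues ss * 3 + bit y + bit q) + (bit p + bit y + bit y)                 ≡⟨ collect (trues ss) (bit y) (bit q) (bit p) ⟩
  (bit y + trues ss) * 3 + bit p + bit q                                   ∎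
  where
  open ≤-Reasoning
  regroup : ∀ P Y H T L → P + Y + H + T + Y + L ≡ (T + H + L) + (P + Y + Y)
  regroup = solve-∀
  collect : ∀ S Y Q P → (S * 3 + Y + Q) + (P + Y + Y) ≡ (Y + S) * 3 + P + Q
  collect = solve-∀

cyclic-count : Dominates (lastOr false s) (headOr false s) w s → trues w ≤ trues s * 3
cyclic-count {s = []}     []  = z≤n
cyclic-count {s = y ∷ ss} {w} dom = +-cancelʳ-≤ (bit y + bit (lastOr y ss)) (trues w) (trues (y ∷ ss) * 3) (begin
  trues w + (bit y + bit (lastOr y ss))              ≡⟨ +-assoc (trues w) _ _ ⟨
  trues w + bit y + bit (lastOr y ss)                ≤⟨ dominated-count dom ⟩
  trues (y ∷ ss) * 3 + bit (lastOr y ss) + bit y     ≡⟨ +-assoc (trues (y ∷ ss) * 3) _ _ ⟩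
  trues (y ∷ ss) * 3 + (bit (lastOr y ss) + bit y)   ≡⟨ cong (trues (y ∷ ss) * 3 +_) (+-comm _ (bit y)) ⟩
  trues (y ∷ ss) * 3 + (bit y + bit (lastOr y ss))   ∎)
  where open ≤-Reasoning

-- From words to subsets of the cycle

private variable
  S W : Subset n
  u v : Fin n

∈⇒lookup : u ∈ S → lookup S u ≡ true
∈⇒lookup = Vecₚ.[]=⇒lookup

lookup⇒∈ : lookup S u ≡ true → u ∈ S
lookup⇒∈ {S = S} {u = u} = Vecₚ.lookup⇒[]= u S

∣∣≡trues : (S : Subset n) → ∣ S ∣ ≡ trues (toList S)
∣∣≡trues []          = refl
∣∣≡trues (true ∷ S)  = cong suc (∣∣≡trues S)
∣∣≡trues (false ∷ S) = ∣∣≡trues S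

⊑⇒⊆ : toList S ⊑ toList W → S ⊆ W
⊑⇒⊆ {S = _ ∷ _} {W = _ ∷ _} (b≤b ∷ _)  here      = here
⊑⇒⊆ {S = _ ∷ _} {W = _ ∷ _} (_   ∷ rs) (there i) = there (⊑⇒⊆ rs i)

Precedes : Fin n → Fin n → Set
Precedes {n} u v = toℕ v ≡ suc (toℕ u) ⊎ (toℕ v ≡ 0 × suc (toℕ u) ≡ n)

CycleAdj⇒Precedes : CycleAdj n u v → Precedes u v ⊎ Precedes v u
CycleAdj⇒Precedes (inj₁ e)               = inj₁ (inj₁ e)
CycleAdj⇒Precedes (inj₂ (inj₁ e))        = inj₂ (inj₁ e)
CycleAdj⇒Precedes (inj₂ (inj₂ (inj₁ e))) = inj₁ (inj₂ e)
CycleAdj⇒Precedes (inj₂ (inj₂ (inj₂ e))) = inj₂ (inj₂ e)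

Precedes⇒CycleAdj : Precedes u v → CycleAdj n u v
Precedes⇒CycleAdj (inj₁ e) = inj₁ e
Precedes⇒CycleAdj (inj₂ e) = inj₂ (inj₂ (inj₁ e))

Precedes⇒CycleAdj′ : Precedes v u → CycleAdj n u v
Precedes⇒CycleAdj′ (inj₁ e) = inj₂ (inj₁ e)
Precedes⇒CycleAdj′ (inj₂ e) = inj₂ (inj₂ (inj₂ e))

leftOf rightOf : Bool → Vec Bool n → Fin n → Bool
leftOf p (x ∷ xs) zero    = p
leftOf p (x ∷ xs) (suc i) = leftOf x xs i
rightOf q (x ∷ xs) zero    = headOr q (toList xs)
rightOf q (x ∷ xs) (suc i) = rightOf q xs i

lookup-first : ∀ d (S : Subset n) → toℕ u ≡ 0 → lookup S u ≡ headOr d (toList S)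
lookup-first {u = zero} d (x ∷ S) _ = refl

lookup-last : ∀ d (S : Subset n) → suc (toℕ u) ≡ n → lookup S u ≡ lastOr d (toList S)
lookup-last {u = zero}  d (x ∷ [])    _  = refl
lookup-last {u = suc u} d (x ∷ S)     eq = lookup-last x S (suc-injective eq)

leftOf-zero : ∀ (S : Subset n) → toℕ v ≡ 0 → leftOf p S v ≡ p
leftOf-zero {v = zero} (x ∷ S) _ = refl

leftOf-suc : ∀ (S : Subset n) → toℕ v ≡ suc (toℕ u) → leftOf p S v ≡ lookup S u
leftOf-suc {v = suc v} {u = zero}  (x ∷ S) eq = leftOf-zero S (suc-injective eq)
leftOf-suc {v = suc v} {u = suc u} (x ∷ S) eq = leftOf-suc S (suc-injective eq)

leftOf-true : ∀ (S : Subset n) → leftOf p S v ≡ true →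
              (toℕ v ≡ 0 × p ≡ true) ⊎ ∃[ u ] toℕ v ≡ suc (toℕ u) × lookup S u ≡ true
leftOf-true {v = zero}  (x ∷ S) e = inj₁ (refl , e)
leftOf-true {v = suc v} (x ∷ S) e with leftOf-true S e
... | inj₁ (v≡0 , x≡true)  = inj₂ (zero , cong suc v≡0 , x≡true)
... | inj₂ (u , eq , Su)   = inj₂ (suc u , cong suc eq , Su)

rightOf-last : ∀ (S : Subset n) → suc (toℕ v) ≡ n → rightOf q S v ≡ q
rightOf-last {v = zero}  (x ∷ [])    _  = refl
rightOf-last {v = suc v} (x ∷ S)     eq = rightOf-last S (suc-injective eq)

rightOf-pred : ∀ (S : Subset n) → toℕ u ≡ suc (toℕ v) → rightOf q S v ≡ lookup S u
rightOf-pred {u = suc u} {v = zero}  (x ∷ S) eq = sym (lookup-first _ S (suc-injective eq))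
rightOf-pred {u = suc u} {v = suc v} (x ∷ S) eq = rightOf-pred S (suc-injective eq)

rightOf-true : ∀ (S : Subset n) → rightOf q S v ≡ true →
               (suc (toℕ v) ≡ n × q ≡ true) ⊎ ∃[ u ] toℕ u ≡ suc (toℕ v) × lookup S u ≡ true
rightOf-true {v = zero}  (x ∷ [])    e = inj₁ (refl , e)
rightOf-true {v = zero}  (x ∷ y ∷ S) e = inj₂ (suc zero , refl , e)
rightOf-true {v = suc v} (x ∷ S)     e with rightOf-true S e
... | inj₁ (eq , q≡true) = inj₁ (cong suc eq , q≡true)
... | inj₂ (u , eq , Su) = inj₂ (suc u , cong suc eq , Su)

leftOf-cyclic : ∀ (S : Subset n) → Precedes u v → lookup S u ≡ true → leftOf (lastOr false (toList S)) S v ≡ true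
leftOf-cyclic S (inj₁ eq)          Su = trans (leftOf-suc S eq) Su
leftOf-cyclic S (inj₂ (v≡0 , u≡n)) Su = trans (leftOf-zero S v≡0) (trans (sym (lookup-last false S u≡n)) Su)

rightOf-cyclic : ∀ (S : Subset n) → Precedes v u → lookup S u ≡ true → rightOf (headOr false (toList S)) S v ≡ true
rightOf-cyclic S (inj₁ eq)          Su = trans (rightOf-pred S eq) Su
rightOf-cyclic S (inj₂ (u≡0 , v≡n)) Su = trans (rightOf-last S v≡n) (trans (sym (lookup-first false S u≡0)) Su)

leftOf-cyclic⁻ : ∀ (S : Subset n) → leftOf (lastOr false (toList S)) S v ≡ true → ∃[ u ] lookup S u ≡ true × Precedes u v
leftOf-cyclic⁻ {suc n} {v} S left with leftOf-true S left
... | inj₁ (v≡0 , last) = fromℕ n , trans (lookup-last false S n+1≡) last , inj₂ (v≡0 , n+1≡)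
  where n+1≡ = cong suc (toℕ-fromℕ n)
... | inj₂ (u , eq , Su) = u , Su , inj₁ eq

rightOf-cyclic⁻ : ∀ (S : Subset n) → rightOf (headOr false (toList S)) S v ≡ true → ∃[ u ] lookup S u ≡ true × Precedes v u
rightOf-cyclic⁻ S@(_ ∷ _) right with rightOf-true S right
... | inj₁ (v≡n , first) = zero , first , inj₂ (refl , v≡n)
... | inj₂ (u , eq , Su) = u , Su , inj₁ eq

independent-leftOf : ∀ (S : Subset n) → Independent p (toList S) → leftOf p S v ≡ true → lookup S v ≡ true → ⊥
independent-leftOf {v = zero}  (true ∷ S) (() ∷ _) refl refl
independent-leftOf {v = suc v} (x ∷ S)    (_ ∷ ind) left Sv   = independent-leftOf S ind left Sv

CoveredAt : Bool → Bool → Subset n → Subset n → Fin n → Set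
CoveredAt p q W S v = Covered (leftOf p S v) (lookup S v) (rightOf q S v) (lookup W v)

Dominates⇒CoveredAt : ∀ (W S : Subset n) → Dominates p q (toList W) (toList S) → ∀ v → CoveredAt p q W S v
Dominates⇒CoveredAt (_ ∷ W) (_ ∷ S) (d ∷ _)   zero    = d
Dominates⇒CoveredAt (_ ∷ W) (_ ∷ S) (_ ∷ dom) (suc v) = Dominates⇒CoveredAt W S dom v

CoveredAt⇒Dominates : ∀ (W S : Subset n) → (∀ v → CoveredAt p q W S v) → Dominates p q (toList W) (toList S)
CoveredAt⇒Dominates []      []      _   = []
CoveredAt⇒Dominates (_ ∷ W) (_ ∷ S) cov = cov zero ∷ CoveredAt⇒Dominates W S (cov ∘ suc)

IsCyclicIDS⇒IsIndepDom : IsCyclicIDS (toList W) (toList S) → IsIndepDom (CycleAdj n) W S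
IsCyclicIDS⇒IsIndepDom {n} {W} {S} (incl , ind , dom) = ⊑⇒⊆ incl , independent , dominating
  where
  independent : ∀ u v → u ∈ S → v ∈ S → ¬ CycleAdj n u v
  independent u v u∈S v∈S adj with CycleAdj⇒Precedes adj
  ... | inj₁ u→v = independent-leftOf S ind (leftOf-cyclic S u→v (∈⇒lookup u∈S)) (∈⇒lookup v∈S)
  ... | inj₂ v→u = independent-leftOf S ind (leftOf-cyclic S v→u (∈⇒lookup v∈S)) (∈⇒lookup u∈S)
  dominating : ∀ v → v ∈ W → v ∉ S → ∃[ u ] (u ∈ S × CycleAdj n u v)
  dominating v v∈W v∉S with Dominates⇒CoveredAt W S dom v (∈⇒lookup v∈W)
  ... | inj₁ left with leftOf-cyclic⁻ S left
  ...   | u , Su , u→v = u , lookup⇒∈ Su , Precedes⇒CycleAdj u→v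
  dominating v v∈W v∉S | inj₂ (inj₁ Sv) = ⊥-elim (v∉S (lookup⇒∈ Sv))
  dominating v v∈W v∉S | inj₂ (inj₂ right) with rightOf-cyclic⁻ S right
  ...   | u , Su , v→u = u , lookup⇒∈ Su , Precedes⇒CycleAdj′ v→u

IsIndepDom⇒Dominates : IsIndepDom (CycleAdj n) W S → Dominates (lastOr false (toList S)) (headOr false (toList S)) (toList W) (toList S)
IsIndepDom⇒Dominates {W = W} {S = S} (_ , _ , dominating) = CoveredAt⇒Dominates W S covered
  where
  covered : ∀ v → CoveredAt (lastOr false (toList S)) (headOr false (toList S)) W S v
  covered v Wv with lookup S v in Sv
  ... | true  = by-itself Wv
  ... | false with dominating v (lookup⇒∈ Wv) (λ v∈S → case trans (sym Sv) (∈⇒lookup v∈S) of λ ())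
  ...   | u , u∈S , adj with CycleAdj⇒Precedes adj
  ...     | inj₁ u→v = inj₁ (leftOf-cyclic S u→v (∈⇒lookup u∈S))
  ...     | inj₂ v→u = inj₂ (inj₂ (rightOf-cyclic S v→u (∈⇒lookup u∈S)))

cycle-domination-bound : IsIndepDom (CycleAdj n) W S → ∣ W ∣ ≤ ∣ S ∣ * 3
cycle-domination-bound {W = W} {S = S} ids =
  subst₂ (λ w s → w ≤ s * 3) (sym (∣∣≡trues W)) (sym (∣∣≡trues S)) (cyclic-count (IsIndepDom⇒Dominates ids))

fromList-⊑ : ∀ (W : Subset n) → s ⊑ toList W → ∃[ S ] toList {n = n} S ≡ s
fromList-⊑ []      []       = [] , refl
fromList-⊑ (_ ∷ W) (_ ∷ rs) with fromList-⊑ W rs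
... | S , refl = _ ∷ S , refl

realise : IsCyclicIDS (toList W) s → ∃[ S ] IsIndepDom (CycleAdj n) W S × ∣ S ∣ ≡ trues s
realise {W = W} cyc with fromList-⊑ W (proj₁ cyc)
... | S , refl = S , IsCyclicIDS⇒IsIndepDom cyc , ∣∣≡trues S

-- Independent domination numbers

m*3≤n*3+2⇒m≤n : ∀ {a b} → a * 3 ≤ b * 3 + 2 → a ≤ b
m*3≤n*3+2⇒m≤n {a} {b} h = ≤-pred (*-cancelʳ-< 3 a (suc b) (≤-<-trans h (≤-reflexive (below b))))
  where
  below : ∀ b → suc (b * 3 + 2) ≡ suc b * 3
  below = solve-∀

isIndepDomNum-cycle : IsIndepDom (CycleAdj n) W S → ∣ S ∣ * 3 ≤ m * 3 + 2 → m * 3 ≤ ∣ W ∣ + 2 →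
                      IsIndepDomNum (CycleAdj n) W m
isIndepDomNum-cycle {n} {W} {S} {m} ids upper lower =
  (S , ids , ≤-antisym (m*3≤n*3+2⇒m≤n upper) (minimal S ids)) , minimal
  where
  minimal : ∀ S′ → IsIndepDom (CycleAdj n) W S′ → m ≤ ∣ S′ ∣
  minimal S′ ids′ = m*3≤n*3+2⇒m≤n (≤-trans lower (+-monoˡ-≤ 2 (cycle-domination-bound ids′)))

cycle-γ : ∀ n → 3 ≤ n → n ≤ m * 3 → m * 3 ≤ n + 2 → IsIndepDomNum (CycleAdj n) ⊤ m
cycle-γ {m} n (s≤s (s≤s (s≤s _))) n≤ ≤n+2 =
  let S , ids , ∣S∣≡ = realise {W = ⊤} cyc
  in  isIndepDomNum-cycle ids (upper ∣S∣≡) (subst (λ c → m * 3 ≤ c + 2) (sym (∣⊤∣≡n n)) ≤n+2)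
  where
  run = replicate n true
  cyc : IsCyclicIDS (toList (⊤ {n})) (greedy run)
  cyc = subst (λ w → IsCyclicIDS w (greedy run)) (sym (Vecₚ.toList-replicate n true)) (greedy-cyclic run refl)
  upper : ∀ {c} → c ≡ trues (greedy run) → c * 3 ≤ m * 3 + 2
  upper refl = ≤-trans (greedy-replicate n) (+-monoˡ-≤ 2 n≤)

falses-∁ : (R : Subset n) → falses (toList (∁ R)) ≡ ∣ R ∣
falses-∁ []          = refl
falses-∁ (true ∷ R)  = cong suc (falses-∁ R)
falses-∁ (false ∷ R) = falses-∁ R

∣∁p∣+∣p∣≡n : (R : Subset n) → ∣ ∁ R ∣ + ∣ R ∣ ≡ n
∣∁p∣+∣p∣≡n R = trans (cong (_+ ∣ R ∣) (∣∁p∣≡n∸∣p∣ R)) (m∸n+n≡m (∣p∣≤n R))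

removal-upper-bound : (R : Subset n) → 1 ≤ ∣ R ∣ →
                      ∃[ S ] IsIndepDom (CycleAdj n) (∁ R) S × ∣ S ∣ * 3 ≤ ∣ ∁ R ∣ + ∣ R ∣ * 2
removal-upper-bound R 1≤∣R∣ =
  let s , cyc , bound = cyclic-upper-bound (toList (∁ R)) (subst (1 ≤_) (sym (falses-∁ R)) 1≤∣R∣)
      S , ids , ∣S∣≡  = realise cyc
  in  S , ids , subst₂ (λ a b → a * 3 ≤ b) (sym ∣S∣≡)
                  (cong₂ (λ c r → c + r * 2) (sym (∣∣≡trues (∁ R))) (falses-∁ R)) bound

γ-after-removal : (R : Subset n) → 1 ≤ ∣ R ∣ → n + ∣ R ∣ ≤ m * 3 + 2 → m * 3 + ∣ R ∣ ≤ n + 2 →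
                  IsIndepDomNum (CycleAdj n) (∁ R) m
γ-after-removal {n} {m} R 1≤∣R∣ up lo =
  let S , ids , bound = removal-upper-bound R 1≤∣R∣
  in  isIndepDomNum-cycle ids (upper bound) lower
  where
  c = ∣ ∁ R ∣
  r = ∣ R ∣
  open ≤-Reasoning
  upper : ∀ {k} → k ≤ c + r * 2 → k ≤ m * 3 + 2
  upper {k} bound = begin
    k              ≤⟨ bound ⟩
    c + r * 2      ≡⟨ regroup c r ⟩
    (c + r) + r    ≡⟨ cong (_+ r) (∣∁p∣+∣p∣≡n R) ⟩
    n + r          ≤⟨ up ⟩
    m * 3 + 2      ∎
    where
    regroup : ∀ c r → c + r * 2 ≡ (c + r) + r
    regroup = solve-∀
  lower : m * 3 ≤ c + 2
  lower = +-cancelʳ-≤ r (m * 3) (c + 2) (begin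
    m * 3 + r      ≤⟨ lo ⟩
    n + 2          ≡⟨ cong (_+ 2) (∣∁p∣+∣p∣≡n R) ⟨
    c + r + 2      ≡⟨ +-assoc c r 2 ⟩
    c + (r + 2)    ≡⟨ cong (c +_) (+-comm r 2) ⟩
    c + (2 + r)    ≡⟨ +-assoc c 2 r ⟨
    c + 2 + r      ∎)

prefix : ∀ t j → Subset (t + j)
prefix t j = Vec.replicate t true Vec.++ Vec.replicate j false

∣prefix∣ : ∀ t j → ∣ prefix t j ∣ ≡ t
∣prefix∣ zero    j = ∣⊥∣≡0 j
∣prefix∣ (suc t) j = cong suc (∣prefix∣ t j)

toList-∁-prefix : ∀ t j → toList (∁ (prefix t j)) ≡ replicate t false ++ replicate j true
toList-∁-prefix (suc t) j       = cong (false ∷_) (toList-∁-prefix t j)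
toList-∁-prefix zero    zero    = refl
toList-∁-prefix zero    (suc j) = cong (true ∷_) (toList-∁-prefix zero j)

greedy-skips-falses : ∀ t w → trues (greedy (replicate t false ++ w)) ≡ trues (greedy w)
greedy-skips-falses zero    w = refl
greedy-skips-falses (suc t) w = greedy-skips-falses t w

prefix-γ : ∀ t j → j ≤ m * 3 → m * 3 ≤ j + 2 → IsIndepDomNum (CycleAdj (suc t + j)) (∁ (prefix (suc t) j)) m
prefix-γ {m} t j j≤ ≤j+2 =
  let S , ids , ∣S∣≡ = realise {W = ∁ (prefix (suc t) j)} cyc
  in  isIndepDomNum-cycle ids (upper ∣S∣≡) (subst (λ c → m * 3 ≤ c + 2) (sym ∣∁prefix∣) ≤j+2)
  where
  path = replicate (suc t) false ++ replicate j true
  cyc : IsCyclicIDS (toList (∁ (prefix (suc t) j))) (greedy path)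
  cyc = subst (λ w → IsCyclicIDS w (greedy path)) (sym (toList-∁-prefix (suc t) j)) (greedy-cyclic path refl)
  upper : ∀ {c} → c ≡ trues (greedy path) → c * 3 ≤ m * 3 + 2
  upper refl = subst (λ c → c * 3 ≤ m * 3 + 2) (sym (greedy-skips-falses (suc t) (replicate j true)))
                     (≤-trans (greedy-replicate j) (+-monoˡ-≤ 2 j≤))
  ∣∁prefix∣ : ∣ ∁ (prefix (suc t) j) ∣ ≡ j
  ∣∁prefix∣ = trans (∣∁p∣≡n∸∣p∣ (prefix (suc t) j)) (trans (cong (suc t + j ∸_) (∣prefix∣ (suc t) j)) (m+n∸m≡n (suc t) j))

-- Stability

isIndepDomNum-unique : ∀ {Adj : Rel n} {W a b} → IsIndepDomNum Adj W a → IsIndepDomNum Adj W b → a ≡ b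
isIndepDomNum-unique ((Sa , ia , ∣Sa∣) , min-a) ((Sb , ib , ∣Sb∣) , min-b) =
  ≤-antisym (subst (_ ≤_) ∣Sb∣ (min-a Sb ib)) (subst (_ ≤_) ∣Sa∣ (min-b Sa ia))

isIdStability-intro : ∀ {Adj : Rel n} {t m m′} → IsIndepDomNum Adj ⊤ m →
                      (∀ R → ∣ R ∣ < t → IsIndepDomNum Adj (∁ R) m) →
                      (R₀ : Subset n) → ∣ R₀ ∣ ≡ t → IsIndepDomNum Adj (∁ R₀) m′ → m ≢ m′ →
                      IsIdStability Adj t
isIdStability-intro γ keep R₀ ∣R₀∣ γ₀ m≢m′ =
  (R₀ , ∣R₀∣ , _ , _ , γ , γ₀ , m≢m′) ,
  λ R ∣R∣<t (_ , _ , γa , γb , a≢b) → a≢b (trans (isIndepDomNum-unique γa γ) (isIndepDomNum-unique (keep R ∣R∣<t) γb))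

-- The equations say m = ⌈n/3⌉ (as t ≤ 2) and m′ = γ_i(P_j), where P_j is C_n
-- without its first 1 + t vertices.
cycle-isIdStability : ∀ t j m m′ → t ≤ 2 → 3 ≤ suc t + j → t + m * 3 ≡ 2 + (suc t + j) → m′ * 3 ≡ j →
                      IsIdStability (CycleAdj (suc t + j)) (suc t)
cycle-isIdStability t j m m′ t≤2 3≤N tm≡ m′≡ =
  isIdStability-intro γ keep (prefix (suc t) j) (∣prefix∣ (suc t) j)
    (prefix-γ t j (≤-reflexive (sym m′≡)) (≤-trans (≤-reflexive m′≡) (m≤m+n j 2))) m≢m′
  where
  N = suc t + j
  open ≤-Reasoning
  γ : IsIndepDomNum (CycleAdj N) ⊤ m
  γ = cycle-γ N 3≤N (+-cancelˡ-≤ 2 N (m * 3) (begin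
        2 + N      ≡⟨ tm≡ ⟨
        t + m * 3  ≤⟨ +-monoˡ-≤ (m * 3) t≤2 ⟩
        2 + m * 3  ∎))
      (begin
        m * 3      ≤⟨ m≤n+m (m * 3) t ⟩
        t + m * 3  ≡⟨ tm≡ ⟩
        2 + N      ≡⟨ +-comm 2 N ⟩
        N + 2      ∎)
  keep : ∀ R → ∣ R ∣ < suc t → IsIndepDomNum (CycleAdj N) (∁ R) m
  keep R ∣R∣<1+t with ∣ R ∣ ≟ 0
  ... | yes ∣R∣≡0 = subst (λ W → IsIndepDomNum (CycleAdj N) W m)
                          (sym (∣p∣≡n⇒p≡⊤ (trans (∣∁p∣≡n∸∣p∣ R) (cong (N ∸_) ∣R∣≡0)))) γ
  ... | no ∣R∣≢0 = γ-after-removal R (n≢0⇒n>0 ∣R∣≢0) up lo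
    where
    ∣R∣≤t = ≤-pred ∣R∣<1+t
    up : N + ∣ R ∣ ≤ m * 3 + 2
    up = +-cancelˡ-≤ t _ _ (begin
      t + (N + ∣ R ∣)  ≤⟨ +-mono-≤ t≤2 (+-monoʳ-≤ N (≤-trans ∣R∣≤t t≤2)) ⟩
      2 + (N + 2)      ≡⟨ +-assoc 2 N 2 ⟨
      2 + N + 2        ≡⟨ cong (_+ 2) tm≡ ⟨
      t + m * 3 + 2    ≡⟨ +-assoc t (m * 3) 2 ⟩
      t + (m * 3 + 2)  ∎)
    lo : m * 3 + ∣ R ∣ ≤ N + 2
    lo = begin
      m * 3 + ∣ R ∣  ≤⟨ +-monoʳ-≤ (m * 3) ∣R∣≤t ⟩
      m * 3 + t      ≡⟨ +-comm (m * 3) t ⟩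
      t + m * 3      ≡⟨ tm≡ ⟩
      2 + N          ≡⟨ +-comm 2 N ⟩
      N + 2          ∎
  m≢m′ : m ≢ m′
  m≢m′ refl = m≢1+n+m (t + j) {2} (trans (cong (t +_) (sym m′≡)) tm≡)

residue-form : ∀ n → 3 ≤ n → ∃[ k ] n ≡ n % 3 + suc k * 3
residue-form n 3≤n with n / 3 | m≡m%n+[m/n]*n n 3
... | zero  | n≡r+0 = ⊥-elim (<⇒≱ (subst (_< 3) (sym (trans n≡r+0 (+-identityʳ _))) (m%n<n n 3)) 3≤n)
... | suc k | n≡    = k , n≡

mainTheorem4 : (n : ℕ) → 3 ≤ n →
    (n % 3 ≡ 0 → IsIdStability (CycleAdj n) 3) ×
    (n % 3 ≡ 2 → IsIdStability (CycleAdj n) 2) ×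
    (n % 3 ≡ 1 → IsIdStability (CycleAdj n) 1)
mainTheorem4 n 3≤n =
  (λ r≡0 → at r≡0 (cycle-isIdStability 2 (k * 3)     (suc k)       k       ≤-refl     3≤ refl refl)) ,
  (λ r≡2 → at r≡2 (cycle-isIdStability 1 (suc k * 3) (suc (suc k)) (suc k) (s≤s z≤n)  3≤ refl refl)) ,
  (λ r≡1 → at r≡1 (cycle-isIdStability 0 (suc k * 3) (suc (suc k)) (suc k) z≤n        3≤ refl refl))
  where
  k = proj₁ (residue-form n 3≤n)
  3≤ : ∀ {i} → 3 ≤ 3 + i
  3≤ = s≤s (s≤s (s≤s z≤n))
  at : ∀ {r t} → n % 3 ≡ r → IsIdStability (CycleAdj (r + suc k * 3)) t → IsIdStability (CycleAdj n) t
  at r≡ = subst (λ n → IsIdStability (CycleAdj n) _) (sym (trans (proj₂ (residue-form n 3≤n)) (cong (_+ suc k * 3) r≡)))
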